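{- Let $\preceq_{c}$ be a multi-believability relation satisfying $\preceq_{c}$-transitivity and $\preceq_{c}$-counter dominance. If it satisfies $\preceq_{c}$-union in addition, then (1) it satisfies $\preceq_{c}$-completeness; (2) it satisfies $\preceq_{c}$-weak coupling if and only if it satisfies $\preceq_{c}$-coupling.
   Context: $\mathcal{L}$ is a propositional language with consequence operation $\mathrm{Cn}$ (supraclassical, compact, satisfying the deduction property); $X \vdash \varphi$ means $\varphi \in \mathrm{Cn}(X)$. A multi-believability relation $\preceq_{c}$ is a binary relation on the set of finite subsets of $\mathcal{L}$, with symmetric part $\simeq_{c}$ and strict part $\prec_{c}$; $\{\varphi\}$ is written $\varphi$. For sets $A,B$, write $A \wedge B$ for $\{\varphi \wedge \psi \mid \varphi \in A, \psi \in B\}$ (so $A \wedge \varphi = \{\psi \wedge \varphi \mid \psi \in A\}$), and $A \wedge B \wedge C$ for $(A\wedge B)\wedge C$. All sets below are finite. Postulates: $\preceq_{c}$-transitivity: if $A \preceq_{c} B$ and $B \preceq_{c} C$ then $A \preceq_{c} C$. $\preceq_{c}$-weak coupling: if $A \simeq_{c} \{\varphi\wedge\psi \mid \varphi\in A,\psi\in B\}$ and $A \simeq_{c} \{\varphi\wedge\chi \mid \varphi\in A,\chi\in C\}$, then $A \simeq_{c} \{(\varphi\wedge\psi)\wedge\chi \mid \varphi\in A,\psi\in B,\chi\in C\}$. $\preceq_{c}$-coupling: if $A \simeq_{c} B$ then $A \simeq_{c} \{\varphi\wedge\psi \mid \varphi\in A,\psi\in B\}$. $\preceq_{c}$-counter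 dominance: if for every $\varphi \in B$ there is $\psi \in A$ with $\varphi \vdash \psi$, then $A \preceq_{c} B$. $\preceq_{c}$-completeness: $A \preceq_{c} B$ or $B \preceq_{c} A$. $\preceq_{c}$-union: $A \preceq_{c} A \cup B$ or $B \preceq_{c} A \cup B$. -}

module Defs where

open import Data.Bool using (Bool; true; false; not; _∧_; _∨_)
open import Data.List using (List; []; _∷_; map; concatMap; _++_)
open import Data.List.Membership.Propositional using (_∈_)
open import Data.Product using (Σ; _×_; _,_)
open import Data.Sum using (_⊎_)
open import Relation.Binary.PropositionalEquality using (_≡_)
open import Level using (Level)

data Form (Atom : Set) : Set where
  var  : Atom → Form Atom
  ⊤ᶠ   : Form Atom
  ⊥ᶠ   : Form Atom
  ¬ᶠ_  : Form Atom → Form Atom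
  _∧ᶠ_ : Form Atom → Form Atom → Form Atom
  _∨ᶠ_ : Form Atom → Form Atom → Form Atom
  _⇒ᶠ_ : Form Atom → Form Atom → Form Atom

module _ {Atom : Set} where

  eval : (Atom → Bool) → Form Atom → Bool
  eval v (var a)   = v a
  eval v ⊤ᶠ        = true
  eval v ⊥ᶠ        = false
  eval v (¬ᶠ φ)    = not (eval v φ)
  eval v (φ ∧ᶠ ψ)  = eval v φ ∧ eval v ψ
  eval v (φ ∨ᶠ ψ)  = eval v φ ∨ eval v ψ
  eval v (φ ⇒ᶠ ψ)  = not (eval v φ) ∨ eval v ψ

  -- sets of formulas (arbitrary, possibly infinite) as predicates
  FSet : Set₁
  FSet = Form Atom → Set

  _⊆ˢ_ : FSet → FSet → Set
  X ⊆ˢ Y = ∀ φ → X φ → Y φ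

  _∪ˢ_ : FSet → FSet → FSet
  (X ∪ˢ Y) φ = X φ ⊎ Y φ

  ⟦_⟧ˢ : Form Atom → FSet
  ⟦ φ ⟧ˢ ψ = ψ ≡ φ

  fromList : List (Form Atom) → FSet
  fromList xs φ = φ ∈ xs

  _⊨_ : FSet → Form Atom → Set
  X ⊨ φ = ∀ (v : Atom → Bool) → (∀ ψ → X ψ → eval v ψ ≡ true) → eval v φ ≡ true

  record ConsequenceOp : Set₁ where
    field
      Cn           : FSet → FSet
      inclusion    : ∀ X → X ⊆ˢ Cn X
      monotony     : ∀ X Y → X ⊆ˢ Y → Cn X ⊆ˢ Cn Y
      iteration    : ∀ X → Cn (Cn X) ⊆ˢ Cn X
      supraclassical : ∀ X φ → X ⊨ φ → Cn X φ
      compact      : ∀ X φ → Cn X φ →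
                     Σ (List (Form Atom)) λ ys → (fromList ys ⊆ˢ X) × Cn (fromList ys) φ
      deduction    : ∀ X φ ψ → (Cn (X ∪ˢ ⟦ φ ⟧ˢ) ψ → Cn X (φ ⇒ᶠ ψ))
                                × (Cn X (φ ⇒ᶠ ψ) → Cn (X ∪ˢ ⟦ φ ⟧ˢ) ψ)

  module Postulates (C : ConsequenceOp) where
    open ConsequenceOp C

    _⊢_ : Form Atom → Form Atom → Set
    φ ⊢ ψ = Cn ⟦ φ ⟧ˢ ψ

    -- finite subsets of L are represented by lists
    FinSet : Set
    FinSet = List (Form Atom)

    _⋀_ : FinSet → FinSet → FinSet
    A ⋀ B = concatMap (λ φ → map (λ ψ → φ ∧ᶠ ψ) B) A

    _≈ₛ_ : FinSet → FinSet → Set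
    A ≈ₛ B = ∀ φ → (φ ∈ A → φ ∈ B) × (φ ∈ B → φ ∈ A)

    -- a multi-believability relation: a binary relation on finite subsets of L
    -- (i.e. on lists, independent of the chosen list representation)
    record MultiBelievability : Set₁ where
      field
        _≼_       : FinSet → FinSet → Set
        set-ext   : ∀ A A' B B' → A ≈ₛ A' → B ≈ₛ B' → A ≼ B → A' ≼ B'

    module _ (M : MultiBelievability) where
      open MultiBelievability M

      _≃_ : FinSet → FinSet → Set
      A ≃ B = (A ≼ B) × (B ≼ A)

      Transitivity : Set
      Transitivity = ∀ A B C → A ≼ B → B ≼ C → A ≼ C

      WeakCoupling : Set
      WeakCoupling = ∀ A B C → A ≃ (A ⋀ B) → A ≃ (A ⋀ C) → A ≃ ((A ⋀ B) ⋀ C)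

      Coupling : Set
      Coupling = ∀ A B → A ≃ B → A ≃ (A ⋀ B)

      CounterDominance : Set
      CounterDominance = ∀ A B → (∀ φ → φ ∈ B → Σ (Form Atom) λ ψ → (ψ ∈ A) × (φ ⊢ ψ)) → A ≼ B

      Completeness : Set
      Completeness = ∀ A B → (A ≼ B) ⊎ (B ≼ A)

      Union : Set
      Union = ∀ A B → (A ≼ (A ++ B)) ⊎ (B ≼ (A ++ B))

-- Counter dominance makes A ≼ B whenever every element of B classically entails one of A;
-- in particular A ⋀ B and A ++ B are ≼-below their components.  Union then turns the
-- inequalities A ++ B ≼ A, A ++ B ≼ B into completeness.  For coupling from weak coupling,
-- put D = A ++ B: union gives A, B ≼ D, hence D ≃ D ⋀ A and D ≃ D ⋀ B, and weak coupling
-- yields D ≃ (D ⋀ A) ⋀ B, whose elements entail those of A ⋀ B.  Conversely, coupling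
-- applied to A ⋀ B ≃ A ⋀ C gives weak coupling.
module Submission where

open import Defs
open import Data.Bool using (true; _∧_)
open import Data.Product using (Σ; _×_; _,_; proj₂)
open import Data.Sum using (inj₁; inj₂)
open import Data.List using ([]; _∷_; map; _++_; cartesianProductWith)
open import Data.List.Membership.Propositional using (_∈_)
open import Data.List.Membership.Propositional.Properties
  using (∈-++⁺ˡ; ∈-++⁺ʳ; ∈-cartesianProductWith⁺; ∈-cartesianProductWith⁻)
open import Function using (_∘_)
open import Relation.Binary.PropositionalEquality using (_≡_; refl; cong; subst; sym)

∧-elimˡ : ∀ x y → x ∧ y ≡ true → x ≡ true
∧-elimˡ true  _ _ = refl

∧-elimʳ : ∀ x y → x ∧ y ≡ true → y ≡ true
∧-elimʳ true  _ p = p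

∧-intro : ∀ {x y} → x ≡ true → y ≡ true → x ∧ y ≡ true
∧-intro refl refl = refl

module _ {Atom : Set} (C : ConsequenceOp {Atom}) where
  open ConsequenceOp C
  open Postulates C

  infix 4 _⊨₁_

  _⊨₁_ : Form Atom → Form Atom → Set
  φ ⊨₁ ψ = ∀ v → eval v φ ≡ true → eval v ψ ≡ true

  ⊨₁⇒⊢ : ∀ {φ ψ} → φ ⊨₁ ψ → φ ⊢ ψ
  ⊨₁⇒⊢ {φ} {ψ} φ⊨ψ = supraclassical ⟦ φ ⟧ˢ ψ (λ v holds → φ⊨ψ v (holds φ refl))

  ⊨₁-trans : ∀ {φ ψ χ} → φ ⊨₁ ψ → ψ ⊨₁ χ → φ ⊨₁ χ
  ⊨₁-trans φ⊨ψ ψ⊨χ v = ψ⊨χ v ∘ φ⊨ψ v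

  -- The premise of counter dominance with ⊢ weakened to classical entailment, which, unlike ⊢,
  -- composes through conjunctions without appeal to the properties of Cn.
  Covers : FinSet → FinSet → Set
  Covers A B = ∀ φ → φ ∈ B → Σ (Form Atom) λ ψ → (ψ ∈ A) × (φ ⊨₁ ψ)

  ⋀≡cartesianProductWith : ∀ A B → A ⋀ B ≡ cartesianProductWith _∧ᶠ_ A B
  ⋀≡cartesianProductWith []      B = refl
  ⋀≡cartesianProductWith (φ ∷ A) B = cong (map (φ ∧ᶠ_) B ++_) (⋀≡cartesianProductWith A B)

  ∈-⋀⁺ : ∀ {A B φ ψ} → φ ∈ A → ψ ∈ B → (φ ∧ᶠ ψ) ∈ (A ⋀ B)
  ∈-⋀⁺ {A} {B} φ∈A ψ∈B =
    subst (_ ∈_) (sym (⋀≡cartesianProductWith A B)) (∈-cartesianProductWith⁺ _∧ᶠ_ φ∈A ψ∈B)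

  ∈-⋀⁻ : ∀ A B {χ} → χ ∈ (A ⋀ B) →
         Σ (Form Atom) λ φ → Σ (Form Atom) λ ψ → φ ∈ A × ψ ∈ B × χ ≡ φ ∧ᶠ ψ
  ∈-⋀⁻ A B χ∈ = ∈-cartesianProductWith⁻ _∧ᶠ_ A B (subst (_ ∈_) (⋀≡cartesianProductWith A B) χ∈)

  covers-⊆ : ∀ {A B} → (∀ φ → φ ∈ B → φ ∈ A) → Covers A B
  covers-⊆ B⊆A φ φ∈B = φ , B⊆A φ φ∈B , λ _ h → h

  covers-refl : ∀ A → Covers A A
  covers-refl A = covers-⊆ λ _ φ∈A → φ∈A

  covers-trans : ∀ {A B E} → Covers A B → Covers B E → Covers A E
  covers-trans A▹B B▹E χ χ∈E with B▹E χ χ∈E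
  ... | ψ , ψ∈B , χ⊨ψ with A▹B ψ ψ∈B
  ...   | φ , φ∈A , ψ⊨φ = φ , φ∈A , ⊨₁-trans {χ} {ψ} {φ} χ⊨ψ ψ⊨φ

  covers-⋀ˡ : ∀ A B → Covers A (A ⋀ B)
  covers-⋀ˡ A B χ χ∈ with ∈-⋀⁻ A B χ∈
  ... | φ , ψ , φ∈A , _ , refl = φ , φ∈A , λ v → ∧-elimˡ (eval v φ) (eval v ψ)

  covers-⋀ʳ : ∀ A B → Covers B (A ⋀ B)
  covers-⋀ʳ A B χ χ∈ with ∈-⋀⁻ A B χ∈
  ... | φ , ψ , _ , ψ∈B , refl = ψ , ψ∈B , λ v → ∧-elimʳ (eval v φ) (eval v ψ)

  covers-⋀-mono : ∀ {A A′ B B′} → Covers A A′ → Covers B B′ → Covers (A ⋀ B) (A′ ⋀ B′)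
  covers-⋀-mono {A′ = A′} {B′ = B′} A▹A′ B▹B′ χ χ∈ with ∈-⋀⁻ A′ B′ χ∈
  ... | φ′ , ψ′ , φ′∈ , ψ′∈ , refl with A▹A′ φ′ φ′∈ | B▹B′ ψ′ ψ′∈
  ...   | φ , φ∈A , φ′⊨φ | ψ , ψ∈B , ψ′⊨ψ =
    φ ∧ᶠ ψ , ∈-⋀⁺ φ∈A ψ∈B , λ v h →
      ∧-intro (φ′⊨φ v (∧-elimˡ (eval v φ′) (eval v ψ′) h))
              (ψ′⊨ψ v (∧-elimʳ (eval v φ′) (eval v ψ′) h))

  covers-⋀-diagonal : ∀ A → Covers (A ⋀ A) A
  covers-⋀-diagonal A φ φ∈A = φ ∧ᶠ φ , ∈-⋀⁺ φ∈A φ∈A , λ _ h → ∧-intro h h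

  module _ (M : MultiBelievability) (tr : Transitivity M) (cd : CounterDominance M) where
    open MultiBelievability M

    infixr 5 _⟫_

    _⟫_ : ∀ {A B E} → A ≼ B → B ≼ E → A ≼ E
    _⟫_ {A} {B} {E} = tr A B E

    ≼-covers : ∀ {A B} → Covers A B → A ≼ B
    ≼-covers {A} {B} A▹B = cd A B λ φ φ∈B → let ψ , ψ∈A , φ⊨ψ = A▹B φ φ∈B in ψ , ψ∈A , ⊨₁⇒⊢ φ⊨ψ

    ≼-⋀ : ∀ A B → A ≼ (A ⋀ B)
    ≼-⋀ A B = ≼-covers (covers-⋀ˡ A B)

    ++-≼ˡ : ∀ A B → (A ++ B) ≼ A
    ++-≼ˡ A B = ≼-covers (covers-⊆ λ _ → ∈-++⁺ˡ)

    ++-≼ʳ : ∀ A B → (A ++ B) ≼ B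
    ++-≼ʳ A B = ≼-covers (covers-⊆ λ _ → ∈-++⁺ʳ A)

    ≃-⋀-of-⊆ : ∀ {D E} → (∀ φ → φ ∈ E → φ ∈ D) → E ≼ D → _≃_ M D (D ⋀ E)
    ≃-⋀-of-⊆ {D} {E} E⊆D E≼D =
      ≼-⋀ D E , ≼-covers (covers-trans (covers-⋀-mono (covers-⊆ E⊆D) (covers-refl E))
                                       (covers-⋀-diagonal E)) ⟫ E≼D

    completeness : Union M → Completeness M
    completeness un A B with un A B
    ... | inj₁ A≼A++B = inj₁ (A≼A++B ⟫ ++-≼ʳ A B)
    ... | inj₂ B≼A++B = inj₂ (B≼A++B ⟫ ++-≼ˡ A B)

    weakCoupling⇒coupling : Union M → WeakCoupling M → Coupling M
    weakCoupling⇒coupling un wc A B (A≼B , B≼A) = ≼-⋀ A B , A⋀B≼A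
      where
      D = A ++ B

      A≼D : A ≼ D
      A≼D with un A B
      ... | inj₁ A≼D = A≼D
      ... | inj₂ B≼D = A≼B ⟫ B≼D

      D≃D⋀A⋀B : _≃_ M D ((D ⋀ A) ⋀ B)
      D≃D⋀A⋀B = wc D A B (≃-⋀-of-⊆ (λ _ → ∈-++⁺ˡ) A≼D)
                         (≃-⋀-of-⊆ (λ _ → ∈-++⁺ʳ A) (B≼A ⟫ A≼D))

      A⋀B≼A : (A ⋀ B) ≼ A
      A⋀B≼A = ≼-covers (covers-⋀-mono (covers-⋀ʳ D A) (covers-refl B))
              ⟫ proj₂ D≃D⋀A⋀B ⟫ ++-≼ˡ A B

    coupling⇒weakCoupling : Coupling M → WeakCoupling M
    coupling⇒weakCoupling c A B E (A≼A⋀B , A⋀B≼A) (A≼A⋀E , A⋀E≼A) =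
      ≼-covers (covers-trans {B = A ⋀ B} (covers-⋀ˡ A B) (covers-⋀ˡ (A ⋀ B) E)) ,
      ≼-covers (covers-⋀-mono (covers-refl (A ⋀ B)) (covers-⋀ʳ A E))
        ⟫ proj₂ (c (A ⋀ B) (A ⋀ E) (A⋀B≼A ⟫ A≼A⋀E , A⋀E≼A ⟫ A≼A⋀B)) ⟫ A⋀B≼A

mainTheorem8 : {Atom : Set} (C : ConsequenceOp {Atom}) (M : Postulates.MultiBelievability C) →
    Postulates.Transitivity C M → Postulates.CounterDominance C M → Postulates.Union C M →
    Postulates.Completeness C M
    × ((Postulates.WeakCoupling C M → Postulates.Coupling C M)
       × (Postulates.Coupling C M → Postulates.WeakCoupling C M))
mainTheorem8 C M tr cd un =
  completeness C M tr cd un ,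
  weakCoupling⇒coupling C M tr cd un ,
  coupling⇒weakCoupling C M tr cd
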